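{- Let $q$ be odd with $q\equiv1\pmod3$, let $\rho\in\mathbb{F}_q^*$, and let $N_{q,\rho}=\#\{\gamma\in\mathbb{F}_q^*:1+4\rho^{ -1}\gamma^3\text{ is a non-square in }\mathbb{F}_q\}$. Then $3\mid N_{q,\rho}$. Moreover, if $-2\rho$ is a cube in $\mathbb{F}_q$, then $6\mid N_{q,\rho}$. -}

module Defs where

open import Level using (Level; _⊔_) renaming (suc to lsuc)
open import Data.Nat using (ℕ)
open import Data.Fin using (Fin)
open import Data.Fin.Properties using (any?)
open import Data.List using (List; length; filter)
open import Data.List using () renaming (allFin to allFinL)
open import Data.Product using (Σ; ∃; _×_; _,_)
open import Relation.Nullary using (¬_; Dec)
open import Relation.Nullary.Decidable using (_×-dec_; ¬?)
open import Relation.Binary.Definitions using (Decidable)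
open import Relation.Binary.PropositionalEquality using (_≡_)
open import Algebra.Bundles using (CommutativeRing)

-- Its number of elements q is  size.
record FiniteField (c ℓ : Level) : Set (lsuc (c ⊔ ℓ)) where
  field
    commRing  : CommutativeRing c ℓ
  open CommutativeRing commRing public
  field
    _≟_       : Decidable _≈_
    1≉0       : ¬ (1# ≈ 0#)
    inverse   : ∀ x → ¬ (x ≈ 0#) → ∃ λ y → x * y ≈ 1#
    size      : ℕ
    enum      : Fin size → Carrier
    enum-surj : ∀ x → ∃ λ i → enum i ≈ x
    enum-inj  : ∀ i j → enum i ≈ enum j → i ≡ j

module _ {c ℓ} (F : FiniteField c ℓ) where
  open FiniteField F

  IsSquare : Carrier → Set ℓ
  IsSquare x = ∃ λ (i : Fin size) → enum i * enum i ≈ x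

  isSquare? : ∀ x → Dec (IsSquare x)
  isSquare? x = any? (λ i → (enum i * enum i) ≟ x)

  IsCube : Carrier → Set (c ⊔ ℓ)
  IsCube x = ∃ λ y → y * y * y ≈ x

  four : Carrier
  four = 1# + 1# + 1# + 1#

  expr : Carrier → Carrier → Carrier
  expr ρinv γ = 1# + four * ρinv * (γ * γ * γ)

  N : Carrier → ℕ
  N ρinv = length (filter (λ i → ¬? (enum i ≟ 0#) ×-dec ¬? (isSquare? (expr ρinv (enum i))))
                          (allFinL size))

-- Let ω be a root of X² + X + 1; it exists because x ↦ -(1 + x)⁻¹ permutes F ∖ {0, -1}, a set of
-- q - 2 ≢ 0 (mod 3) elements, with order 3, and its fixed points are exactly these roots. As
-- ω³ = 1 ≠ ω, multiplication by ω permutes the counted γ in orbits of length 3.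
-- If -2ρ = c³ then κ = c²ρ⁻¹ satisfies κ³ = 4ρ⁻¹, and u = 1 + κγ turns the condition on γ into
-- "u ≠ 1 and 1 + (u - 1)³ is a non-square". The involution u ↦ 3/u preserves this set because
-- (1 + (3/u - 1)³) u⁴ = 9 (1 + (u - 1)³). Its fixed points, u² = 3, are exchanged by u ↦ -u, which
-- preserves the set because there the two values of 1 + (u - 1)³ multiply to -27, while
-- -3 = (1 + 2ω)² is a square. So the counted set splits into pairs.
module Submission where

open import Defs
open import Level using (Level)
open import Algebra.Bundles using (CommutativeRing)
open import Data.Nat as ℕ using (ℕ; zero; suc; s<s; _%_)
open import Data.Nat.Divisibility using (_∣_; divides; n∣m⇒m%n≡0; ∣m∣n⇒∣m+n)
open import Data.Nat.DivMod using ([m+kn]%n≡m%n)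
open import Data.Nat.LCM using (lcm-least)
import Data.Nat.Properties as ℕ
open import Data.Integer using (+_)
open import Data.Fin using (Fin)
import Data.Fin.Properties as Fin
open import Data.Product using (∃; _×_; _,_; proj₁; proj₂)
open import Function using (_∘_)
open import Relation.Nullary using (¬_; yes; no; contradiction)
open import Relation.Nullary.Decidable using (¬?; _×-dec_)
open import Relation.Unary using (Pred; Decidable; U; ∁; _∩_; _≐_)
open import Relation.Unary.Properties using (U?; _∩?_; ∁?)
open import Relation.Binary.Definitions using (_Respects_)
open import Relation.Binary.PropositionalEquality as ≡ using (_≡_; _≢_)

-- The ring solver of Algebra.Solver.Ring with integer coefficients, so that subtraction is
-- available over any commutative ring. Numerals are interpreted by the optimised n · 1#, so that
-- con (+ 2) and con (+ 4) denote 1# + 1# and 1# + 1# + 1# + 1# on the nose.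
module IntegerCoefficients {c ℓ : Level} (R : CommutativeRing c ℓ) where

  open import Data.Integer as ℤ using (ℤ; -[1+_]; _⊖_; sign; ∣_∣; _◃_)
  import Data.Integer.Properties as ℤ
  open import Data.Sign as Sign using (Sign)
  open import Data.Maybe using (Maybe; just; nothing)
  open CommutativeRing R
  open import Algebra.Properties.Ring ring using (-‿involutive; -‿distribˡ-*; -‿distribʳ-*; -0#≈0#)
  open import Algebra.Properties.AbelianGroup +-abelianGroup using (⁻¹-∙-comm)
  open import Algebra.Properties.Semiring.Mult.TCOptimised semiring
    using (1+×; ×-homo-+; ×1-homo-*) renaming (_×_ to _·_)
  open import Algebra.Solver.Ring.AlmostCommutativeRing
    using (fromCommutativeRing; _-Raw-AlmostCommutative⟶_)
  open import Relation.Binary.Reasoning.Setoid setoid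

  ⟦_⟧ℤ : ℤ → Carrier
  ⟦ + n ⟧ℤ = n · 1#
  ⟦ -[1+ n ] ⟧ℤ = - (suc n · 1#)

  ⊖-homo : ∀ m n → ⟦ m ⊖ n ⟧ℤ ≈ m · 1# - n · 1#
  ⊖-homo m       zero    = sym (trans (+-congˡ -0#≈0#) (+-identityʳ _))
  ⊖-homo zero    (suc n) = sym (+-identityˡ _)
  ⊖-homo (suc m) (suc n) = begin
    ⟦ suc m ⊖ suc n ⟧ℤ              ≡⟨ ≡.cong ⟦_⟧ℤ (ℤ.[1+m]⊖[1+n]≡m⊖n m n) ⟩
    ⟦ m ⊖ n ⟧ℤ                      ≈⟨ ⊖-homo m n ⟩
    m · 1# - n · 1#                 ≈⟨ sym (1+a-[1+b]≈a-b (m · 1#) (n · 1#)) ⟩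
    (1# + m · 1#) - (1# + n · 1#)   ≈⟨ sym (+-cong (1+× m 1#) (-‿cong (1+× n 1#))) ⟩
    suc m · 1# - suc n · 1#         ∎
    where
    1+a-[1+b]≈a-b : ∀ a b → (1# + a) - (1# + b) ≈ a - b
    1+a-[1+b]≈a-b a b = begin
      (1# + a) - (1# + b)     ≈⟨ +-congˡ (sym (⁻¹-∙-comm 1# b)) ⟩
      (1# + a) + (- 1# + - b) ≈⟨ +-assoc 1# a _ ⟩
      1# + (a + (- 1# + - b)) ≈⟨ +-congˡ (trans (sym (+-assoc a _ _)) (trans (+-congʳ (+-comm a _)) (+-assoc _ a _))) ⟩
      1# + (- 1# + (a - b))   ≈⟨ sym (+-assoc 1# _ _) ⟩
      (1# + - 1#) + (a - b)   ≈⟨ +-congʳ (-‿inverseʳ 1#) ⟩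
      0# + (a - b)            ≈⟨ +-identityˡ _ ⟩
      a - b                   ∎

  +-homo : ∀ i j → ⟦ i ℤ.+ j ⟧ℤ ≈ ⟦ i ⟧ℤ + ⟦ j ⟧ℤ
  +-homo (+ m)     (+ n)     = ×-homo-+ 1# m n
  +-homo (+ m)     -[1+ n ]  = ⊖-homo m (suc n)
  +-homo -[1+ m ]  (+ n)     = trans (⊖-homo n (suc m)) (+-comm _ _)
  +-homo -[1+ m ]  -[1+ n ]  = begin
    - (suc (suc (m ℕ.+ n)) · 1#)     ≡⟨ ≡.cong (λ k → - (suc k · 1#)) (≡.sym (ℕ.+-suc m n)) ⟩
    - ((suc m ℕ.+ suc n) · 1#)       ≈⟨ -‿cong (×-homo-+ 1# (suc m) (suc n)) ⟩
    - (suc m · 1# + suc n · 1#)      ≈⟨ sym (⁻¹-∙-comm _ _) ⟩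
    - (suc m · 1#) + - (suc n · 1#)  ∎

  -‿homo : ∀ i → ⟦ ℤ.- i ⟧ℤ ≈ - ⟦ i ⟧ℤ
  -‿homo (+ zero)  = sym -0#≈0#
  -‿homo (+ suc n) = refl
  -‿homo -[1+ n ]  = sym (-‿involutive _)

  ⟦_⟧ₛ : Sign → Carrier
  ⟦ Sign.+ ⟧ₛ = 1#
  ⟦ Sign.- ⟧ₛ = - 1#

  ◃-homo : ∀ s n → ⟦ s ◃ n ⟧ℤ ≈ ⟦ s ⟧ₛ * (n · 1#)
  ◃-homo s      zero    = sym (zeroʳ _)
  ◃-homo Sign.+ (suc n) = sym (*-identityˡ _)
  ◃-homo Sign.- (suc n) = trans (-‿cong (sym (*-identityˡ _))) (-‿distribˡ-* 1# _)

  sign-homo : ∀ s t → ⟦ s Sign.* t ⟧ₛ ≈ ⟦ s ⟧ₛ * ⟦ t ⟧ₛ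
  sign-homo Sign.+ t      = sym (*-identityˡ _)
  sign-homo Sign.- Sign.+ = sym (*-identityʳ _)
  sign-homo Sign.- Sign.- = begin
    1#             ≈⟨ sym (-‿involutive 1#) ⟩
    - (- 1#)       ≈⟨ -‿cong (sym (*-identityʳ _)) ⟩
    - (- 1# * 1#)  ≈⟨ -‿distribʳ-* _ _ ⟩
    - 1# * - 1#    ∎

  ⟦⟧-sign-abs : ∀ i → ⟦ i ⟧ℤ ≈ ⟦ sign i ⟧ₛ * (∣ i ∣ · 1#)
  ⟦⟧-sign-abs i = trans (reflexive (≡.cong ⟦_⟧ℤ (≡.sym (ℤ.◃-inverse i)))) (◃-homo (sign i) ∣ i ∣)

  *-homo : ∀ i j → ⟦ i ℤ.* j ⟧ℤ ≈ ⟦ i ⟧ℤ * ⟦ j ⟧ℤ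
  *-homo i j = begin
    ⟦ sign i Sign.* sign j ◃ ∣ i ∣ ℕ.* ∣ j ∣ ⟧ℤ
      ≈⟨ ◃-homo (sign i Sign.* sign j) (∣ i ∣ ℕ.* ∣ j ∣) ⟩
    ⟦ sign i Sign.* sign j ⟧ₛ * ((∣ i ∣ ℕ.* ∣ j ∣) · 1#)
      ≈⟨ *-cong (sign-homo (sign i) (sign j)) (×1-homo-* ∣ i ∣ ∣ j ∣) ⟩
    (⟦ sign i ⟧ₛ * ⟦ sign j ⟧ₛ) * ((∣ i ∣ · 1#) * (∣ j ∣ · 1#))
      ≈⟨ interchange _ _ _ _ ⟩
    (⟦ sign i ⟧ₛ * (∣ i ∣ · 1#)) * (⟦ sign j ⟧ₛ * (∣ j ∣ · 1#))
      ≈⟨ *-cong (sym (⟦⟧-sign-abs i)) (sym (⟦⟧-sign-abs j)) ⟩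
    ⟦ i ⟧ℤ * ⟦ j ⟧ℤ ∎
    where
    interchange : ∀ a b x y → (a * b) * (x * y) ≈ (a * x) * (b * y)
    interchange a b x y = begin
      (a * b) * (x * y)  ≈⟨ *-assoc a b _ ⟩
      a * (b * (x * y))  ≈⟨ *-congˡ (trans (sym (*-assoc b x y)) (trans (*-congʳ (*-comm b x)) (*-assoc x b y))) ⟩
      a * (x * (b * y))  ≈⟨ sym (*-assoc a x _) ⟩
      (a * x) * (b * y)  ∎

  ℤ-morphism : ℤ.+-*-rawRing -Raw-AlmostCommutative⟶ fromCommutativeRing R
  ℤ-morphism = record
    { ⟦_⟧    = ⟦_⟧ℤ
    ; +-homo = +-homo
    ; *-homo = *-homo
    ; -‿homo = -‿homo
    ; 0-homo = refl
    ; 1-homo = refl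
    }

  ℤ-coeff≟ : ∀ i j → Maybe (⟦ i ⟧ℤ ≈ ⟦ j ⟧ℤ)
  ℤ-coeff≟ i j with i ℤ.≟ j
  ... | yes ≡.refl = just refl
  ... | no  _      = nothing

  open import Algebra.Solver.Ring ℤ.+-*-rawRing (fromCommutativeRing R) ℤ-morphism ℤ-coeff≟ public
    using (Polynomial; solve; _:=_; con; _:+_; _:*_; _:-_; :-_)

module Counting where

  open import Data.Nat using (_+_; _<_; _∸_; z<s)
  open import Data.Nat.Divisibility using (_∣0; ∣-refl)
  open import Data.Nat.Induction using (<-wellFounded)
  open import Induction.WellFounded using (Acc; acc)
  open import Data.Fin using (zero; suc; toℕ; fromℕ<)
  open import Data.Fin.Properties using (any?; suc-injective; 0≢1+n; toℕ<n; toℕ-injective; toℕ-fromℕ<)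
    renaming (_≟_ to _≟ᶠ_)
  open import Data.List using (length; filter; tabulate)
  open import Data.Bool using (if_then_else_)
  open import Function using (id)
  open import Function.Definitions using (Injective)
  open import Relation.Nullary using (does)
  open import Relation.Unary using (_⊆_)
  open import Relation.Binary.Definitions using (tri<; tri≈; tri>)
  open ≡ using (refl; sym; trans; cong; subst)

  private variable
    a p q : Level
    A : Set a
    n : ℕ

  count : {P : Pred (Fin n) p} → Decidable P → ℕ
  count {n = zero}  P? = 0
  count {n = suc n} P? = (if does (P? zero) then suc else id) (count (P? ∘ suc))

  length-filter-tabulate : {P : Pred A p} (P? : Decidable P) (f : Fin n → A) →
                           length (filter P? (tabulate f)) ≡ count (P? ∘ f)
  length-filter-tabulate {n = zero}  P? f = refl
  length-filter-tabulate {n = suc n} P? f with P? (f zero)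
  ... | yes _ = cong suc (length-filter-tabulate P? (f ∘ suc))
  ... | no _  = length-filter-tabulate P? (f ∘ suc)

  count-≐ : {P : Pred (Fin n) p} {Q : Pred (Fin n) q} (P? : Decidable P) (Q? : Decidable Q) →
            P ≐ Q → count P? ≡ count Q?
  count-≐ {n = zero}  P? Q? _ = refl
  count-≐ {n = suc n} P? Q? (P⊆Q , Q⊆P) with P? zero | Q? zero
  ... | yes _ | yes _  = cong suc (count-≐ (P? ∘ suc) (Q? ∘ suc) (P⊆Q , Q⊆P))
  ... | no _  | no _   = count-≐ (P? ∘ suc) (Q? ∘ suc) (P⊆Q , Q⊆P)
  ... | yes p | no ¬q  = contradiction (P⊆Q p) ¬q
  ... | no ¬p | yes q  = contradiction (Q⊆P q) ¬p

  count-partition : {P : Pred (Fin n) p} {Q : Pred (Fin n) q}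
                    (P? : Decidable P) (Q? : Decidable Q) →
                    count P? ≡ count (P? ∩? Q?) + count (P? ∩? ∁? Q?)
  count-partition {n = zero}  P? Q? = refl
  count-partition {n = suc n} P? Q? with P? zero | Q? zero
  ... | yes _ | yes _ = cong suc (count-partition (P? ∘ suc) (Q? ∘ suc))
  ... | yes _ | no _  = trans (cong suc (count-partition (P? ∘ suc) (Q? ∘ suc))) (sym (ℕ.+-suc _ _))
  ... | no _  | _     = count-partition (P? ∘ suc) (Q? ∘ suc)

  count-U : count {n = n} U? ≡ n
  count-U {n = zero}  = refl
  count-U {n = suc n} = cong suc (count-U {n = n})

  count-none : {P : Pred (Fin n) p} (P? : Decidable P) → (∀ i → ¬ P i) → count P? ≡ 0
  count-none {n = zero}  P? _ = refl
  count-none {n = suc n} P? ¬P with P? zero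
  ... | yes p = contradiction p (¬P zero)
  ... | no _  = count-none (P? ∘ suc) (¬P ∘ suc)

  count-≡ : (x : Fin n) → count (_≟ᶠ x) ≡ 1
  count-≡ {suc n} zero = cong suc (count-none {n = n} (λ i → suc i ≟ᶠ zero) (λ _ ()))
  count-≡ (suc x)      =
    trans (count-≐ (λ i → suc i ≟ᶠ suc x) (_≟ᶠ x) (suc-injective , cong suc)) (count-≡ x)

  count-remove : {P : Pred (Fin n) p} (P? : Decidable P) {x : Fin n} → P x →
                 count P? ≡ suc (count (P? ∩? ∁? (_≟ᶠ x)))
  count-remove P? {x} Px = begin
    count P?                          ≡⟨ count-partition P? (_≟ᶠ x) ⟩
    count (P? ∩? (_≟ᶠ x)) + rest      ≡⟨ cong (_+ rest) (count-≐ _ (_≟ᶠ x) (proj₂ , λ { refl → Px , refl })) ⟩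
    count (_≟ᶠ x) + rest              ≡⟨ cong (_+ rest) (count-≡ x) ⟩
    suc rest                          ∎
    where
    open ≡.≡-Reasoning
    rest = count (P? ∩? ∁? (_≟ᶠ x))

  Image : {k : ℕ} → (Fin k → Fin n) → Pred (Fin n) _
  Image f i = ∃ λ j → f j ≡ i

  image? : {k : ℕ} (f : Fin k → Fin n) → Decidable (Image f)
  image? f i = any? (λ j → f j ≟ᶠ i)

  count-image : {k : ℕ} (f : Fin k → Fin n) → Injective _≡_ _≡_ f → count (image? f) ≡ k
  count-image {k = zero}  f _     = count-none (image? f) (λ _ ())
  count-image {k = suc k} f f-inj = begin
    count (image? f)                                  ≡⟨ count-remove (image? f) (zero , refl) ⟩
    suc (count (image? f ∩? ∁? (_≟ᶠ f zero)))         ≡⟨ cong suc (count-≐ _ (image? (f ∘ suc)) (into , back)) ⟩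
    suc (count (image? (f ∘ suc)))                    ≡⟨ cong suc (count-image (f ∘ suc) (suc-injective ∘ f-inj)) ⟩
    suc k                                             ∎
    where
    open ≡.≡-Reasoning
    into : (Image f ∩ ∁ (_≡ f zero)) ⊆ Image (f ∘ suc)
    into ((zero  , refl) , i≢f0) = contradiction refl i≢f0
    into ((suc j , fj≡i) , _)    = j , fj≡i
    back : Image (f ∘ suc) ⊆ (Image f ∩ ∁ (_≡ f zero))
    back (j , refl) = (suc j , refl) , λ eq → 0≢1+n (sym (f-inj eq))

  module _ {n : ℕ} (g : Fin n → Fin n) where

    open import Function.Endo.Propositional (Fin n) using (_^_; ^-homo)

    ^-sucʳ : ∀ m i → (g ^ suc m) i ≡ (g ^ m) (g i)
    ^-sucʳ m i = trans (cong (λ e → (g ^ e) i) (ℕ.+-comm 1 m)) (cong (λ h → h i) (^-homo g m 1))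

    record FreeCyclicAction (k : ℕ) (P : Pred (Fin n) p) : Set p where
      field
        closed : ∀ {i} → P i → P (g i)
        period : ∀ {i} → P i → (g ^ k) i ≡ i
        free   : ∀ {i} j → P i → 0 < j → j < k → (g ^ j) i ≢ i

    module Orbit {k : ℕ} {P : Pred (Fin n) p} (act : FreeCyclicAction (suc k) P) where
      open FreeCyclicAction act

      closed^ : ∀ m {i} → P i → P ((g ^ m) i)
      closed^ zero    Pi = Pi
      closed^ (suc m) Pi = closed (closed^ m Pi)

      orbit : Fin n → Fin (suc k) → Fin n
      orbit x j = (g ^ toℕ j) x

      orbit-distinct : ∀ {x} → P x → ∀ a b → toℕ a < toℕ b → orbit x a ≢ orbit x b
      orbit-distinct {x} Px a b a<b eq = free d (closed^ (toℕ a) Px) (ℕ.m<n⇒0<n∸m a<b) d<k (begin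
        (g ^ d) ((g ^ toℕ a) x)    ≡⟨ cong (λ h → h x) (sym (^-homo g d (toℕ a))) ⟩
        (g ^ (d + toℕ a)) x        ≡⟨ cong (λ e → (g ^ e) x) (ℕ.m∸n+n≡m (ℕ.<⇒≤ a<b)) ⟩
        (g ^ toℕ b) x              ≡⟨ sym eq ⟩
        (g ^ toℕ a) x              ∎)
        where
        open ≡.≡-Reasoning
        d = toℕ b ∸ toℕ a
        d<k = ℕ.≤-<-trans (ℕ.m∸n≤m (toℕ b) (toℕ a)) (toℕ<n b)

      orbit-injective : ∀ {x} → P x → Injective _≡_ _≡_ (orbit x)
      orbit-injective Px {a} {b} eq with ℕ.<-cmp (toℕ a) (toℕ b)
      ... | tri< a<b _ _ = contradiction eq (orbit-distinct Px a b a<b)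
      ... | tri≈ _ a≡b _ = toℕ-injective a≡b
      ... | tri> _ _ b<a = contradiction (sym eq) (orbit-distinct Px b a b<a)

      orbit-closed : ∀ {x y} → P x → Image (orbit x) y → Image (orbit x) (g y)
      orbit-closed {x} Px (j , refl) with suc (toℕ j) ℕ.<? suc k
      ... | yes j+1<k = fromℕ< j+1<k , cong (λ e → (g ^ e) x) (toℕ-fromℕ< j+1<k)
      ... | no  j+1≮k = zero , (begin
        x                          ≡⟨ sym (period Px) ⟩
        (g ^ suc k) x              ≡⟨ cong (λ e → (g ^ e) x) (sym (ℕ.≤∧≮⇒≡ (toℕ<n j) j+1≮k)) ⟩
        (g ^ suc (toℕ j)) x        ∎)
        where open ≡.≡-Reasoning

      orbit-closed^ : ∀ m {x y} → P x → Image (orbit x) y → Image (orbit x) ((g ^ m) y)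
      orbit-closed^ zero    Px y∈O = y∈O
      orbit-closed^ (suc m) Px y∈O = orbit-closed Px (orbit-closed^ m Px y∈O)

      -- g i ∈ orbit x forces i = gᵏ (g i) ∈ orbit x
      without-orbit : ∀ {x} → P x → FreeCyclicAction (suc k) (P ∩ ∁ (Image (orbit x)))
      without-orbit Px = record
        { closed = λ { {i} (Pi , i∉O) → closed Pi , λ gi∈O →
                         i∉O (subst (Image _) (trans (sym (^-sucʳ k i)) (period Pi)) (orbit-closed^ k Px gi∈O)) }
        ; period = period ∘ proj₁
        ; free   = λ j → free j ∘ proj₁
        }

      count-without-orbit : ∀ (P? : Decidable P) {x} → P x →
                            count P? ≡ suc k + count (P? ∩? ∁? (image? (orbit x)))
      count-without-orbit P? {x} Px = begin
        count P?                                   ≡⟨ count-partition P? (image? (orbit x)) ⟩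
        count (P? ∩? image? (orbit x)) + rest      ≡⟨ cong (_+ rest) (count-≐ _ (image? (orbit x)) (proj₂ , λ j → in-P j , j)) ⟩
        count (image? (orbit x)) + rest            ≡⟨ cong (_+ rest) (count-image (orbit x) (orbit-injective Px)) ⟩
        suc k + rest                               ∎
        where
        open ≡.≡-Reasoning
        rest = count (P? ∩? ∁? (image? (orbit x)))
        in-P : ∀ {y} → Image (orbit x) y → P y
        in-P (j , refl) = closed^ (toℕ j) Px

    FreeCyclicAction⇒∣count : ∀ {k} {P : Pred (Fin n) p} (P? : Decidable P) →
                              FreeCyclicAction (suc k) P → suc k ∣ count P?
    FreeCyclicAction⇒∣count {k = k} P? act = go P? act (<-wellFounded (count P?))
      where
      go : ∀ {P : Pred (Fin n) p} (P? : Decidable P) → FreeCyclicAction (suc k) P →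
           Acc _<_ (count P?) → suc k ∣ count P?
      go P? act (acc rec) with any? P?
      ... | no ∄P = subst (suc k ∣_) (sym (count-none P? λ i Pi → ∄P (i , Pi))) (suc k ∣0)
      ... | yes (x , Px) = subst (suc k ∣_) (sym split)
              (∣m∣n⇒∣m+n ∣-refl (go (P? ∩? ∁? (image? (orbit x))) (without-orbit Px) (rec smaller)))
        where
        open Orbit act
        rest = count (P? ∩? ∁? (image? (orbit x)))
        split : count P? ≡ suc k + rest
        split = count-without-orbit P? Px
        smaller : rest < count P?
        smaller = subst (rest <_) (sym split) (ℕ.m<n+m rest z<s)

open Counting

module FieldTheory {c ℓ : Level} (F : FiniteField c ℓ) where

  open FiniteField F
  open IntegerCoefficients commRing
  open import Algebra.Definitions _≈_ using (Congruent₁)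
  open import Algebra.Properties.Semiring.Mult.TCOptimised semiring using () renaming (_×_ to _·_)
  open import Algebra.Properties.Group +-group using () renaming (∙-cancelˡ to +-cancelˡ)
  open import Relation.Binary.Reasoning.Setoid setoid

  _⁻¹ : Carrier → Carrier
  x ⁻¹ with x ≟ 0#
  ... | yes _   = 0#
  ... | no  x≉0 = proj₁ (inverse x x≉0)

  x*x⁻¹≈1 : ∀ {x} → x ≉ 0# → x * x ⁻¹ ≈ 1#
  x*x⁻¹≈1 {x} x≉0 with x ≟ 0#
  ... | yes x≈0 = contradiction x≈0 x≉0
  ... | no  x≉0 = proj₂ (inverse x x≉0)

  *-cancelˡ : ∀ {x a b} → x ≉ 0# → x * a ≈ x * b → a ≈ b
  *-cancelˡ {x} {a} {b} x≉0 xa≈xb = begin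
    a                ≈⟨ *-identityˡ a ⟨
    1# * a           ≈⟨ *-congʳ (x*x⁻¹≈1 x≉0) ⟨
    (x * x ⁻¹) * a   ≈⟨ rearrange x (x ⁻¹) a ⟩
    x ⁻¹ * (x * a)   ≈⟨ *-congˡ xa≈xb ⟩
    x ⁻¹ * (x * b)   ≈⟨ rearrange x (x ⁻¹) b ⟨
    (x * x ⁻¹) * b   ≈⟨ *-congʳ (x*x⁻¹≈1 x≉0) ⟩
    1# * b           ≈⟨ *-identityˡ b ⟩
    b                ∎
    where
    rearrange : ∀ x y a → (x * y) * a ≈ y * (x * a)
    rearrange = solve 3 (λ x y a → (x :* y) :* a := y :* (x :* a)) refl

  x*y≉0 : ∀ {x y} → x ≉ 0# → y ≉ 0# → x * y ≉ 0#
  x*y≉0 {x} x≉0 y≉0 xy≈0 = y≉0 (*-cancelˡ x≉0 (trans xy≈0 (sym (zeroʳ x))))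

  x*y≈1⇒x≉0 : ∀ {x y} → x * y ≈ 1# → x ≉ 0#
  x*y≈1⇒x≉0 {x} {y} xy≈1 x≈0 = 1≉0 (trans (sym xy≈1) (trans (*-congʳ x≈0) (zeroˡ y)))

  ⁻¹-cong : Congruent₁ _⁻¹
  ⁻¹-cong {x} {y} x≈y with x ≟ 0# | y ≟ 0#
  ... | yes _   | yes _   = refl
  ... | yes x≈0 | no  y≉0 = contradiction (trans (sym x≈y) x≈0) y≉0
  ... | no  x≉0 | yes y≈0 = contradiction (trans x≈y y≈0) x≉0
  ... | no  x≉0 | no  y≉0 = *-cancelˡ x≉0 (begin
    x * proj₁ (inverse x x≉0)  ≈⟨ proj₂ (inverse x x≉0) ⟩
    1#                         ≈⟨ proj₂ (inverse y y≉0) ⟨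
    y * proj₁ (inverse y y≉0)  ≈⟨ *-congʳ x≈y ⟨
    x * proj₁ (inverse y y≉0)  ∎)

  -1≉0 : - 1# ≉ 0#
  -1≉0 -1≈0 = 1≉0 (begin
    1#          ≈⟨ solve 0 (con (+ 1) := :- (:- con (+ 1))) refl ⟩
    - (- 1#)    ≈⟨ -‿cong -1≈0 ⟩
    - 0#        ≈⟨ solve 0 (:- con (+ 0) := con (+ 0)) refl ⟩
    0#          ∎)

  index : Carrier → Fin size
  index x = proj₁ (enum-surj x)

  enum-index : ∀ x → enum (index x) ≈ x
  enum-index x = proj₂ (enum-surj x)

  square : ∀ s → IsSquare F (s * s)
  square s = index s , *-cong (enum-index s) (enum-index s)

  IsSquare-resp : IsSquare F Respects _≈_
  IsSquare-resp x≈y (i , s²≈x) = i , trans s²≈x x≈y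

  square-transfer : ∀ {a b k m} → k ≉ 0# → a * (k * k) ≈ b * (m * m) → IsSquare F b → IsSquare F a
  square-transfer {a} {b} {k} {m} k≉0 a·k²≈b·m² (i , s²≈b) = IsSquare-resp root²≈a (square root)
    where
    s = enum i
    root = s * m * k ⁻¹
    root²≈a : root * root ≈ a
    root²≈a = begin
      root * root
        ≈⟨ solve 3 (λ s m k′ → (s :* m :* k′) :* (s :* m :* k′) := (s :* s) :* (m :* m) :* (k′ :* k′)) refl s m (k ⁻¹) ⟩
      (s * s) * (m * m) * (k ⁻¹ * k ⁻¹)
        ≈⟨ *-congʳ (*-congʳ s²≈b) ⟩
      b * (m * m) * (k ⁻¹ * k ⁻¹)
        ≈⟨ *-congʳ a·k²≈b·m² ⟨
      a * (k * k) * (k ⁻¹ * k ⁻¹)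
        ≈⟨ solve 3 (λ a k k′ → a :* (k :* k) :* (k′ :* k′) := a :* ((k :* k′) :* (k :* k′))) refl a k (k ⁻¹) ⟩
      a * ((k * k ⁻¹) * (k * k ⁻¹))
        ≈⟨ *-congˡ (*-cong (x*x⁻¹≈1 k≉0) (x*x⁻¹≈1 k≉0)) ⟩
      a * (1# * 1#)
        ≈⟨ solve 1 (λ a → a :* (con (+ 1) :* con (+ 1)) := a) refl a ⟩
      a ∎

  #_ : ∀ {p} {P : Pred Carrier p} → Decidable P → ℕ
  # P? = count (P? ∘ enum)

  #-≐ : ∀ {p q} {P : Pred Carrier p} {Q : Pred Carrier q} (P? : Decidable P) (Q? : Decidable Q) →
        P ≐ Q → # P? ≡ # Q?
  #-≐ P? Q? (P⊆Q , Q⊆P) = count-≐ (P? ∘ enum) (Q? ∘ enum) (P⊆Q , Q⊆P)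

  #-U : # U? ≡ size
  #-U = count-U

  #-remove : ∀ {p} {P : Pred Carrier p} → P Respects _≈_ → (P? : Decidable P) → ∀ {a} → P a →
             # P? ≡ suc (# (P? ∩? ∁? (_≟ a)))
  #-remove P-resp P? {a} Pa = ≡.trans (count-remove (P? ∘ enum) (P-resp (sym (enum-index a)) Pa))
    (≡.cong suc (count-≐ ((P? ∘ enum) ∩? ∁? (Fin._≟ index a)) ((P? ∩? ∁? (_≟ a)) ∘ enum)
                         ((λ (Pi , i≢a) → Pi , i≢a ∘ ≈a⇒≡) , (λ (Pi , i≉a) → Pi , i≉a ∘ ≡⇒≈a))))
    where
    ≈a⇒≡ : ∀ {i} → enum i ≈ a → i ≡ index a
    ≈a⇒≡ ei≈a = enum-inj _ _ (trans ei≈a (sym (enum-index a)))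
    ≡⇒≈a : ∀ {i} → i ≡ index a → enum i ≈ a
    ≡⇒≈a ≡.refl = enum-index a

  module _ {p} {P : Pred Carrier p} (P-resp : P Respects _≈_) (P? : Decidable P)
           {f : Carrier → Carrier} (f-cong : Congruent₁ f)
           (closed : ∀ {x} → P x → P (f x)) (moves : ∀ {x} → P x → f x ≉ x) where

    private
      lift : Fin size → Fin size
      lift i = index (f (enum i))

      enum-lift : ∀ i → enum (lift i) ≈ f (enum i)
      enum-lift i = enum-index (f (enum i))

      enum-lift² : ∀ i → enum (lift (lift i)) ≈ f (f (enum i))
      enum-lift² i = trans (enum-lift (lift i)) (f-cong (enum-lift i))

      lift-closed : ∀ {i} → P (enum i) → P (enum (lift i))
      lift-closed Pi = P-resp (sym (enum-lift _)) (closed Pi)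

      lift-moves : ∀ {i} → P (enum i) → lift i ≢ i
      lift-moves Pi li≡i = moves Pi (trans (sym (enum-lift _)) (reflexive (≡.cong enum li≡i)))

    involution⇒2∣# : (∀ {x} → P x → f (f x) ≈ x) → 2 ∣ # P?
    involution⇒2∣# f²≈id = FreeCyclicAction⇒∣count lift (P? ∘ enum) (record
      { closed = lift-closed
      ; period = λ Pi → enum-inj _ _ (trans (enum-lift² _) (f²≈id Pi))
      ; free   = λ { 1 Pi _ _ → lift-moves Pi ; 0 _ () _ ; (suc (suc _)) _ _ (s<s (s<s ())) }
      })

    order3⇒3∣# : (∀ {x} → P x → f (f (f x)) ≈ x) → 3 ∣ # P?
    order3⇒3∣# f³≈id = FreeCyclicAction⇒∣count lift (P? ∘ enum) (record
      { closed = lift-closed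
      ; period = lift³≡id
      ; free   = λ { 1 Pi _ _ → lift-moves Pi
                   ; 2 Pi _ _ l²i≡i → lift-moves Pi (≡.trans (≡.cong lift (≡.sym l²i≡i)) (lift³≡id Pi))
                   ; 0 _ () _
                   ; (suc (suc (suc _))) _ _ (s<s (s<s (s<s ()))) }
      })
      where
      lift³≡id : ∀ {i} → P (enum i) → lift (lift (lift i)) ≡ i
      lift³≡id Pi = enum-inj _ _ (trans (enum-lift _) (trans (f-cong (enum-lift² _)) (f³≈id Pi)))

  module _ {A B : Carrier → Carrier} (A-cong : Congruent₁ A) (B-cong : Congruent₁ B)
           (B∘A≈id : ∀ x → B (A x) ≈ x) (A∘B≈id : ∀ u → A (B u) ≈ u)
           {p} {P : Pred Carrier p} (P-resp : P Respects _≈_) (P? : Decidable P)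
           {g : Carrier → Carrier} (g-cong : Congruent₁ g)
           (closed : ∀ {u} → P u → P (g u)) (moves : ∀ {u} → P u → g u ≉ u) where

    involution⇒2∣#∘ : (∀ {u} → P u → g (g u) ≈ u) → 2 ∣ # (P? ∘ A)
    involution⇒2∣#∘ g²≈id = involution⇒2∣# (P-resp ∘ A-cong) (P? ∘ A) (B-cong ∘ g-cong ∘ A-cong)
      (λ PAx → P-resp (sym (A∘B≈id _)) (closed PAx))
      (λ PAx BgAx≈x → moves PAx (trans (sym (A∘B≈id _)) (A-cong BgAx≈x)))
      (λ {x} PAx → trans (B-cong (trans (g-cong (A∘B≈id _)) (g²≈id PAx))) (B∘A≈id x))

  x+1≉x : ∀ x → x + 1# ≉ x
  x+1≉x x x+1≈x = 1≉0 (+-cancelˡ x 1# 0# (trans x+1≈x (sym (+-identityʳ x))))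

  2≉0 : size % 2 ≡ 1 → 2 · 1# ≉ 0#
  2≉0 size≡1 2≈0 = ℕ.0≢1+n (≡.trans (≡.sym (n∣m⇒m%n≡0 size 2 (≡.subst (2 ∣_) #-U 2∣size))) size≡1)
    where
    2∣size = involution⇒2∣# (λ _ _ → _) U? +-congʳ (λ _ → _) (λ {x} _ → x+1≉x x) λ {x} _ → begin
      x + 1# + 1#    ≈⟨ +-assoc x 1# 1# ⟩
      x + 2 · 1#     ≈⟨ +-congˡ 2≈0 ⟩
      x + 0#         ≈⟨ +-identityʳ x ⟩
      x              ∎

  3≉0 : size % 3 ≡ 1 → 3 · 1# ≉ 0#
  3≉0 size≡1 3≈0 = ℕ.0≢1+n (≡.trans (≡.sym (n∣m⇒m%n≡0 size 3 (≡.subst (3 ∣_) #-U 3∣size))) size≡1)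
    where
    3∣size = order3⇒3∣# (λ _ _ → _) U? +-congʳ (λ _ → _) (λ {x} _ → x+1≉x x) λ {x} _ → begin
      x + 1# + 1# + 1#   ≈⟨ solve 1 (λ x → x :+ con (+ 1) :+ con (+ 1) :+ con (+ 1) := x :+ con (+ 3)) refl x ⟩
      x + 3 · 1#         ≈⟨ +-congˡ 3≈0 ⟩
      x + 0#             ≈⟨ +-identityʳ x ⟩
      x                  ∎

  Root : Carrier → Set ℓ
  Root x = x * x + x + 1# ≈ 0#

  Root? : Decidable Root
  Root? x = (x * x + x + 1#) ≟ 0#

  Root-resp : Root Respects _≈_
  Root-resp x≈y root = trans (+-congʳ (+-cong (*-cong (sym x≈y) (sym x≈y)) (sym x≈y))) root

  module Möbius where

    μ : Carrier → Carrier
    μ x = - (1# + x) ⁻¹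

    μ-cong : Congruent₁ μ
    μ-cong = -‿cong ∘ ⁻¹-cong ∘ +-congˡ

    -- (1 + x) y = -1, i.e. y = μ x
    Graph : Carrier → Carrier → Set ℓ
    Graph x y = x * y + y + 1# ≈ 0#

    graph-μ : ∀ {x} → 1# + x ≉ 0# → Graph x (μ x)
    graph-μ {x} 1+x≉0 = begin
      x * μ x + μ x + 1#
        ≈⟨ solve 2 (λ x v → x :* (:- v) :+ (:- v) :+ con (+ 1) := :- ((con (+ 1) :+ x) :* v) :+ con (+ 1))
                   refl x ((1# + x) ⁻¹) ⟩
      - ((1# + x) * (1# + x) ⁻¹) + 1#
        ≈⟨ +-congʳ (-‿cong (x*x⁻¹≈1 1+x≉0)) ⟩
      - 1# + 1#
        ≈⟨ -‿inverseˡ 1# ⟩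
      0# ∎

    graph-functional : ∀ {x y y′} → 1# + x ≉ 0# → Graph x y → Graph x y′ → y ≈ y′
    graph-functional {x} 1+x≉0 graph graph′ = *-cancelˡ 1+x≉0 (trans ([1+x]y≈-1 graph) (sym ([1+x]y≈-1 graph′)))
      where
      [1+x]y≈-1 : ∀ {y} → Graph x y → (1# + x) * y ≈ - 1#
      [1+x]y≈-1 {y} graph = begin
        (1# + x) * y            ≈⟨ solve 2 (λ x y → (con (+ 1) :+ x) :* y := (x :* y :+ y :+ con (+ 1)) :- con (+ 1)) refl x y ⟩
        (x * y + y + 1#) - 1#   ≈⟨ +-congʳ graph ⟩
        0# - 1#                 ≈⟨ +-identityˡ (- 1#) ⟩
        - 1#                    ∎

    graph-cycle : ∀ {x y z} → Graph x y → Graph y z → Graph z x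
    graph-cycle {x} {y} {z} graph₁ graph₂ = begin
      z * x + x + 1#
        ≈⟨ solve 3 (λ x y z → z :* x :+ x :+ con (+ 1)
                              := x :* (y :* z :+ z :+ con (+ 1)) :- z :* (x :* y :+ y :+ con (+ 1)) :+ (y :* z :+ z :+ con (+ 1)))
                   refl x y z ⟩
      x * (y * z + z + 1#) - z * (x * y + y + 1#) + (y * z + z + 1#)
        ≈⟨ +-cong (+-cong (*-congˡ graph₂) (-‿cong (*-congˡ graph₁))) graph₂ ⟩
      x * 0# - z * 0# + 0#
        ≈⟨ solve 2 (λ x z → x :* con (+ 0) :- z :* con (+ 0) :+ con (+ 0) := con (+ 0)) refl x z ⟩
      0# ∎

    Domain : Pred Carrier ℓ
    Domain x = x ≉ 0# × x ≉ - 1#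

    Domain? : Decidable Domain
    Domain? x = ¬? (x ≟ 0#) ×-dec ¬? (x ≟ (- 1#))

    Domain-resp : Domain Respects _≈_
    Domain-resp x≈y (x≉0 , x≉-1) = x≉0 ∘ trans x≈y , x≉-1 ∘ trans x≈y

    1+x≉0 : ∀ {x} → Domain x → 1# + x ≉ 0#
    1+x≉0 {x} (_ , x≉-1) 1+x≈0 = x≉-1 (begin
      x               ≈⟨ solve 1 (λ x → x := (con (+ 1) :+ x) :- con (+ 1)) refl x ⟩
      (1# + x) - 1#   ≈⟨ +-congʳ 1+x≈0 ⟩
      0# - 1#         ≈⟨ +-identityˡ (- 1#) ⟩
      - 1#            ∎)

    μ-closed : ∀ {x} → Domain x → Domain (μ x)
    μ-closed {x} Dx@(x≉0 , _) = μx≉0 , μx≉-1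
      where
      graph = graph-μ (1+x≉0 Dx)
      μx≉0 : μ x ≉ 0#
      μx≉0 μx≈0 = 1≉0 (begin
        1#                   ≈⟨ solve 1 (λ x → con (+ 1) := x :* con (+ 0) :+ con (+ 0) :+ con (+ 1)) refl x ⟩
        x * 0# + 0# + 1#     ≈⟨ +-congʳ (+-cong (*-congˡ μx≈0) μx≈0) ⟨
        x * μ x + μ x + 1#   ≈⟨ graph ⟩
        0#                   ∎)
      μx≉-1 : μ x ≉ - 1#
      μx≉-1 μx≈-1 = x≉0 (begin
        x                          ≈⟨ solve 1 (λ x → x := :- (x :* :- con (+ 1) :+ :- con (+ 1) :+ con (+ 1))) refl x ⟩
        - (x * - 1# + - 1# + 1#)   ≈⟨ -‿cong (+-congʳ (+-cong (*-congˡ μx≈-1) μx≈-1)) ⟨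
        - (x * μ x + μ x + 1#)     ≈⟨ -‿cong graph ⟩
        - 0#                       ≈⟨ solve 0 (:- con (+ 0) := con (+ 0)) refl ⟩
        0#                         ∎)

    μ³≈id : ∀ {x} → Domain x → μ (μ (μ x)) ≈ x
    μ³≈id Dx = graph-functional (1+x≉0 Dz) (graph-μ (1+x≉0 Dz))
                 (graph-cycle (graph-μ (1+x≉0 Dx)) (graph-μ (1+x≉0 Dy)))
      where
      Dy = μ-closed Dx
      Dz = μ-closed Dy

    μ-fixed⇒Root : ∀ {x} → Domain x → μ x ≈ x → Root x
    μ-fixed⇒Root {x} Dx μx≈x = begin
      x * x + x + 1#       ≈⟨ +-congʳ (+-cong (*-congˡ μx≈x) μx≈x) ⟨
      x * μ x + μ x + 1#   ≈⟨ graph-μ (1+x≉0 Dx) ⟩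
      0#                   ∎

    size≡2+#Domain : size ≡ 2 ℕ.+ # Domain?
    size≡2+#Domain =
      ≡.trans (≡.sym #-U) (≡.trans (#-remove (λ _ _ → _) U? _) (≡.cong suc (≡.trans
        (#-remove U∖0-resp (U? ∩? ∁? (_≟ 0#)) (_ , -1≉0))
        (≡.cong suc (#-≐ ((U? ∩? ∁? (_≟ 0#)) ∩? ∁? (_≟ (- 1#))) Domain?
                         ((λ ((_ , x≉0) , x≉-1) → x≉0 , x≉-1) , λ (x≉0 , x≉-1) → (_ , x≉0) , x≉-1))))))
      where
      U∖0-resp : (U ∩ ∁ (_≈ 0#)) Respects _≈_
      U∖0-resp x≈y (_ , x≉0) = _ , x≉0 ∘ trans x≈y

  ∃-root-of-unity : size % 3 ≡ 1 → ∃ Root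
  ∃-root-of-unity size≡1 with Fin.any? (Root? ∘ enum)
  ... | yes (i , root) = enum i , root
  ... | no  ∄root      = contradiction (≡.trans (≡.sym size≡1) size%3≡2) λ ()
    where
    open Möbius
    3∣#Domain : 3 ∣ # Domain?
    3∣#Domain = order3⇒3∣# Domain-resp Domain? μ-cong μ-closed
      (λ {x} Dx μx≈x → ∄root (index x , Root-resp (sym (enum-index x)) (μ-fixed⇒Root Dx μx≈x))) μ³≈id
    size%3≡2 : size % 3 ≡ 2
    size%3≡2 = ≡.trans (≡.cong (_% 3) size≡2+#Domain) ([2+m]%3≡2 3∣#Domain)
      where
      [2+m]%3≡2 : ∀ {m} → 3 ∣ m → (2 ℕ.+ m) % 3 ≡ 2
      [2+m]%3≡2 (divides k ≡.refl) = [m+kn]%n≡m%n 2 k 3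

module Cubic {c ℓ : Level} (F : FiniteField c ℓ) where

  open FiniteField F
  open FieldTheory F
  open IntegerCoefficients commRing
  open import Algebra.Properties.Semiring.Mult.TCOptimised semiring using () renaming (_×_ to _·_)
  open import Relation.Binary.Reasoning.Setoid setoid

  cubic : Carrier → Carrier
  cubic u = 1# + (u - 1#) * (u - 1#) * (u - 1#)

  :cubic : ∀ {n} → Polynomial n → Polynomial n
  :cubic u = con (+ 1) :+ (u :- con (+ 1)) :* (u :- con (+ 1)) :* (u :- con (+ 1))

  cubic-cong : ∀ {u v} → u ≈ v → cubic u ≈ cubic v
  cubic-cong u≈v = +-congˡ (*-cong (*-cong u-1≈v-1 u-1≈v-1) u-1≈v-1)
    where u-1≈v-1 = +-congʳ u≈v

  NonSq : Pred Carrier ℓ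
  NonSq u = u ≉ 1# × ¬ IsSquare F (cubic u)

  NonSq? : Decidable NonSq
  NonSq? u = ¬? (u ≟ 1#) ×-dec ¬? (isSquare? F (cubic u))

  NonSq-resp : NonSq Respects _≈_
  NonSq-resp u≈v (u≉1 , ¬sq) = u≉1 ∘ trans u≈v , ¬sq ∘ IsSquare-resp (cubic-cong (sym u≈v))

  NonSq⇒≉ : ∀ {a u} → cubic a ≈ a * a → NonSq u → u ≉ a
  NonSq⇒≉ {a} cubic-a≈a² (_ , ¬sq) u≈a =
    ¬sq (IsSquare-resp (sym (trans (cubic-cong u≈a) cubic-a≈a²)) (square a))

  NonSq⇒≉0 : ∀ {u} → NonSq u → u ≉ 0#
  NonSq⇒≉0 = NonSq⇒≉ (solve 0 (:cubic (con (+ 0)) := con (+ 0) :* con (+ 0)) refl)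

  NonSq⇒≉3 : ∀ {u} → NonSq u → u ≉ 3 · 1#
  NonSq⇒≉3 = NonSq⇒≉ (solve 0 (:cubic (con (+ 3)) := con (+ 3) :* con (+ 3)) refl)

  Sqrt3 : Pred Carrier ℓ
  Sqrt3 u = u * u ≈ 3 · 1#

  Sqrt3? : Decidable Sqrt3
  Sqrt3? u = (u * u) ≟ (3 · 1#)

  Sqrt3-resp : Sqrt3 Respects _≈_
  Sqrt3-resp u≈v u²≈3 = trans (*-cong (sym u≈v) (sym u≈v)) u²≈3

  module Inversion (3≉0 : 3 · 1# ≉ 0#) where

    ι : Carrier → Carrier
    ι u = 3 · 1# * u ⁻¹

    ι-cong : ∀ {u v} → u ≈ v → ι u ≈ ι v
    ι-cong = *-congˡ ∘ ⁻¹-cong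

    u*ιu≈3 : ∀ {u} → u ≉ 0# → u * ι u ≈ 3 · 1#
    u*ιu≈3 {u} u≉0 = begin
      u * (3 · 1# * u ⁻¹)   ≈⟨ solve 2 (λ u v → u :* (con (+ 3) :* v) := con (+ 3) :* (u :* v)) refl u (u ⁻¹) ⟩
      3 · 1# * (u * u ⁻¹)   ≈⟨ *-congˡ (x*x⁻¹≈1 u≉0) ⟩
      3 · 1# * 1#           ≈⟨ *-identityʳ _ ⟩
      3 · 1#                ∎

    ι-unique : ∀ {u v} → u ≉ 0# → u * v ≈ 3 · 1# → ι u ≈ v
    ι-unique u≉0 uv≈3 = *-cancelˡ u≉0 (trans (u*ιu≈3 u≉0) (sym uv≈3))

    ιu≉0 : ∀ {u} → u ≉ 0# → ι u ≉ 0#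
    ιu≉0 {u} u≉0 ιu≈0 = 3≉0 (trans (sym (u*ιu≈3 u≉0)) (trans (*-congˡ ιu≈0) (zeroʳ u)))

    ι-involutive : ∀ {u} → u ≉ 0# → ι (ι u) ≈ u
    ι-involutive u≉0 = ι-unique (ιu≉0 u≉0) (trans (*-comm _ _) (u*ιu≈3 u≉0))

    cubic-inversion : ∀ {u v} → u * v ≈ 3 · 1# → cubic u * (3 · 1# * 3 · 1#) ≈ cubic v * ((u * u) * (u * u))
    cubic-inversion {u} {v} uv≈3 = sym (begin
      cubic v * ((u * u) * (u * u))
        ≈⟨ solve 2 (λ u v → :cubic v :* ((u :* u) :* (u :* u))
                           := u :* (u :* u :* u :+ (u :* v :- u) :* (u :* v :- u) :* (u :* v :- u))) refl u v ⟩
      u * (u * u * u + (u * v - u) * (u * v - u) * (u * v - u))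
        ≈⟨ *-congˡ (+-congˡ (*-cong (*-cong 3-u 3-u) 3-u)) ⟩
      u * (u * u * u + (3 · 1# - u) * (3 · 1# - u) * (3 · 1# - u))
        ≈⟨ solve 1 (λ u → u :* (u :* u :* u :+ (con (+ 3) :- u) :* (con (+ 3) :- u) :* (con (+ 3) :- u))
                         := :cubic u :* (con (+ 3) :* con (+ 3))) refl u ⟩
      cubic u * (3 · 1# * 3 · 1#) ∎)
      where 3-u = +-congʳ uv≈3

    NonSq-ι : ∀ {u} → NonSq u → NonSq (ι u)
    NonSq-ι {u} nsq@(_ , ¬sq) = ιu≉1 , ¬sq ∘ square-transfer 3≉0 (cubic-inversion (u*ιu≈3 u≉0))
      where
      u≉0 = NonSq⇒≉0 nsq
      ιu≉1 : ι u ≉ 1#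
      ιu≉1 ιu≈1 = NonSq⇒≉3 nsq (trans (sym (*-identityʳ u)) (trans (*-congˡ (sym ιu≈1)) (u*ιu≈3 u≉0)))

    ι-moves : ∀ {u} → NonSq u → ¬ Sqrt3 u → ι u ≉ u
    ι-moves nsq ¬u²≈3 ιu≈u = ¬u²≈3 (trans (*-congˡ (sym ιu≈u)) (u*ιu≈3 (NonSq⇒≉0 nsq)))

    ¬Sqrt3-ι : ∀ {u} → NonSq u → ¬ Sqrt3 u → ¬ Sqrt3 (ι u)
    ¬Sqrt3-ι {u} nsq ¬u²≈3 ιu²≈3 = ι-moves nsq ¬u²≈3
      (*-cancelˡ (ιu≉0 u≉0) (trans ιu²≈3 (trans (sym (u*ιu≈3 u≉0)) (*-comm u (ι u)))))
      where u≉0 = NonSq⇒≉0 nsq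

  -3-square : ∀ {ω} → Root ω → (1# + 2 · 1# * ω) * (1# + 2 · 1# * ω) ≈ - (3 · 1#)
  -3-square {ω} root = begin
    (1# + 2 · 1# * ω) * (1# + 2 · 1# * ω)
      ≈⟨ solve 1 (λ ω → (con (+ 1) :+ con (+ 2) :* ω) :* (con (+ 1) :+ con (+ 2) :* ω)
                       := con (+ 4) :* (ω :* ω :+ ω :+ con (+ 1)) :- con (+ 3)) refl ω ⟩
    4 · 1# * (ω * ω + ω + 1#) - 3 · 1#
      ≈⟨ +-congʳ (*-congˡ root) ⟩
    4 · 1# * 0# - 3 · 1#
      ≈⟨ solve 0 (con (+ 4) :* con (+ 0) :- con (+ 3) := :- con (+ 3)) refl ⟩
    - (3 · 1#) ∎

  cubic-negation : ∀ {u} → Sqrt3 u → cubic u * cubic (- u) ≈ - (27 · 1#)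
  cubic-negation {u} u²≈3 = begin
    cubic u * cubic (- u)
      ≈⟨ solve 1 (λ u → :cubic u :* :cubic (:- u)
                       := :- ((u :* u) :* ((u :* u :+ con (+ 3)) :* (u :* u :+ con (+ 3)) :- con (+ 9) :* (u :* u)))) refl u ⟩
    - (u * u * ((u * u + 3 · 1#) * (u * u + 3 · 1#) - 9 · 1# * (u * u)))
      ≈⟨ -‿cong (*-cong u²≈3 (+-cong (*-cong u²+3≈6 u²+3≈6) (-‿cong (*-congˡ u²≈3)))) ⟩
    - (3 · 1# * ((3 · 1# + 3 · 1#) * (3 · 1# + 3 · 1#) - 9 · 1# * 3 · 1#))
      ≈⟨ solve 0 (:- (con (+ 3) :* ((con (+ 3) :+ con (+ 3)) :* (con (+ 3) :+ con (+ 3)) :- con (+ 9) :* con (+ 3)))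
                  := :- con (+ 27)) refl ⟩
    - (27 · 1#) ∎
    where u²+3≈6 = +-congʳ u²≈3

  module Negation (2≉0 : 2 · 1# ≉ 0#) (3≉0 : 3 · 1# ≉ 0#) {ω : Carrier} (root : Root ω) where

    NonSq-neg : ∀ {u} → NonSq u → Sqrt3 u → NonSq (- u)
    NonSq-neg {u} nsq@(_ , ¬sq) u²≈3 = -u≉1 , ¬sq ∘ square-transfer (x*y≉0 3≉0 s≉0) transfer
      where
      s = 1# + 2 · 1# * ω
      s≉0 : s ≉ 0#
      s≉0 s≈0 = 3≉0 (begin
        3 · 1#          ≈⟨ solve 1 (λ x → x := :- (:- x)) refl (3 · 1#) ⟩
        - (- (3 · 1#))  ≈⟨ -‿cong (-3-square root) ⟨
        - (s * s)       ≈⟨ -‿cong (*-cong s≈0 s≈0) ⟩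
        - (0# * 0#)     ≈⟨ solve 0 (:- (con (+ 0) :* con (+ 0)) := con (+ 0)) refl ⟩
        0#              ∎)
      transfer : cubic u * (3 · 1# * s * (3 · 1# * s)) ≈ cubic (- u) * (cubic u * cubic u)
      transfer = begin
        cubic u * (3 · 1# * s * (3 · 1# * s))
          ≈⟨ solve 2 (λ a s → a :* (con (+ 3) :* s :* (con (+ 3) :* s)) := a :* (con (+ 9) :* (s :* s))) refl (cubic u) s ⟩
        cubic u * (9 · 1# * (s * s))
          ≈⟨ *-congˡ (*-congˡ (-3-square root)) ⟩
        cubic u * (9 · 1# * - (3 · 1#))
          ≈⟨ solve 1 (λ a → a :* (con (+ 9) :* :- con (+ 3)) := :- con (+ 27) :* a) refl (cubic u) ⟩
        - (27 · 1#) * cubic u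
          ≈⟨ *-congʳ (cubic-negation u²≈3) ⟨
        cubic u * cubic (- u) * cubic u
          ≈⟨ solve 2 (λ a b → a :* b :* a := b :* (a :* a)) refl (cubic u) (cubic (- u)) ⟩
        cubic (- u) * (cubic u * cubic u) ∎
      -u≉1 : - u ≉ 1#
      -u≉1 -u≈1 = 2≉0 (begin
        2 · 1#           ≈⟨ solve 0 (con (+ 2) := con (+ 3) :- con (+ 1)) refl ⟩
        3 · 1# - 1#      ≈⟨ +-congʳ u²≈3 ⟨
        u * u - 1#       ≈⟨ solve 1 (λ u → u :* u :- con (+ 1) := (:- u) :* (:- u) :- con (+ 1)) refl u ⟩
        - u * - u - 1#   ≈⟨ +-congʳ (*-cong -u≈1 -u≈1) ⟩
        1# * 1# - 1#     ≈⟨ solve 0 (con (+ 1) :* con (+ 1) :- con (+ 1) := con (+ 0)) refl ⟩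
        0#               ∎)

    Sqrt3-neg : ∀ {u} → Sqrt3 u → Sqrt3 (- u)
    Sqrt3-neg {u} = trans (solve 1 (λ u → :- u :* :- u := u :* u) refl u)

    neg-moves : ∀ {u} → NonSq u → - u ≉ u
    neg-moves {u} nsq -u≈u = x*y≉0 2≉0 (NonSq⇒≉0 nsq) (begin
      2 · 1# * u   ≈⟨ solve 1 (λ u → con (+ 2) :* u := u :- (:- u)) refl u ⟩
      u - (- u)    ≈⟨ +-congˡ (-‿cong -u≈u) ⟩
      u - u        ≈⟨ -‿inverseʳ u ⟩
      0#           ∎)

module Count {c ℓ : Level} (F : FiniteField c ℓ) (ρinv : FiniteField.Carrier F) where

  open FiniteField F
  open FieldTheory F
  open IntegerCoefficients commRing
  open import Algebra.Properties.Ring ring using (-‿involutive)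
  open import Algebra.Properties.Semiring.Mult.TCOptimised semiring using () renaming (_×_ to _·_)
  open import Relation.Binary.Reasoning.Setoid setoid

  Counted : Pred Carrier ℓ
  Counted γ = γ ≉ 0# × ¬ IsSquare F (expr F ρinv γ)

  Counted? : Decidable Counted
  Counted? γ = ¬? (γ ≟ 0#) ×-dec ¬? (isSquare? F (expr F ρinv γ))

  N≡#Counted : N F ρinv ≡ # Counted?
  N≡#Counted = length-filter-tabulate (Counted? ∘ enum) (λ i → i)

  expr-cong : ∀ {x y} → x ≈ y → expr F ρinv x ≈ expr F ρinv y
  expr-cong x≈y = +-congˡ (*-congˡ (*-cong (*-cong x≈y x≈y) x≈y))

  Counted-resp : Counted Respects _≈_
  Counted-resp x≈y (x≉0 , ¬sq) = x≉0 ∘ trans x≈y , ¬sq ∘ IsSquare-resp (expr-cong (sym x≈y))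

  module _ {ω : Carrier} (root : Root ω) (3≉0 : 3 · 1# ≉ 0#) where

    ω³≈1 : ω * ω * ω ≈ 1#
    ω³≈1 = begin
      ω * ω * ω
        ≈⟨ solve 1 (λ ω → ω :* ω :* ω := (ω :- con (+ 1)) :* (ω :* ω :+ ω :+ con (+ 1)) :+ con (+ 1)) refl ω ⟩
      (ω - 1#) * (ω * ω + ω + 1#) + 1#
        ≈⟨ +-congʳ (*-congˡ root) ⟩
      (ω - 1#) * 0# + 1#
        ≈⟨ solve 1 (λ ω → (ω :- con (+ 1)) :* con (+ 0) :+ con (+ 1) := con (+ 1)) refl ω ⟩
      1# ∎

    ω≉1 : ω ≉ 1#
    ω≉1 ω≈1 = 3≉0 (begin
      3 · 1#              ≈⟨ solve 0 (con (+ 3) := con (+ 1) :* con (+ 1) :+ con (+ 1) :+ con (+ 1)) refl ⟩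
      1# * 1# + 1# + 1#   ≈⟨ +-congʳ (+-cong (*-cong ω≈1 ω≈1) ω≈1) ⟨
      ω * ω + ω + 1#      ≈⟨ root ⟩
      0#                  ∎)

    ω≉0 : ω ≉ 0#
    ω≉0 = x*y≈1⇒x≉0 (trans (*-comm ω (ω * ω)) ω³≈1)

    expr-ω* : ∀ γ → expr F ρinv (ω * γ) ≈ expr F ρinv γ
    expr-ω* γ = begin
      1# + four F * ρinv * (ω * γ * (ω * γ) * (ω * γ))
        ≈⟨ solve 3 (λ ω γ r → con (+ 1) :+ con (+ 4) :* r :* (ω :* γ :* (ω :* γ) :* (ω :* γ))
                              := con (+ 1) :+ con (+ 4) :* r :* ((ω :* ω :* ω) :* (γ :* γ :* γ))) refl ω γ ρinv ⟩
      1# + four F * ρinv * (ω * ω * ω * (γ * γ * γ))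
        ≈⟨ +-congˡ (*-congˡ (trans (*-congʳ ω³≈1) (*-identityˡ _))) ⟩
      1# + four F * ρinv * (γ * γ * γ) ∎

    ω*-moves : ∀ {γ} → γ ≉ 0# → ω * γ ≉ γ
    ω*-moves {γ} γ≉0 ωγ≈γ = ω≉1 (*-cancelˡ γ≉0 (trans (*-comm γ ω) (trans ωγ≈γ (sym (*-identityʳ γ)))))

    ω*³≈id : ∀ γ → ω * (ω * (ω * γ)) ≈ γ
    ω*³≈id γ = begin
      ω * (ω * (ω * γ))   ≈⟨ solve 2 (λ ω γ → ω :* (ω :* (ω :* γ)) := ω :* ω :* ω :* γ) refl ω γ ⟩
      ω * ω * ω * γ       ≈⟨ *-congʳ ω³≈1 ⟩
      1# * γ              ≈⟨ *-identityˡ γ ⟩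
      γ                   ∎

    3∣N : 3 ∣ N F ρinv
    3∣N = ≡.subst (3 ∣_) (≡.sym N≡#Counted) (order3⇒3∣# Counted-resp Counted? *-congˡ
      (λ (γ≉0 , ¬sq) → x*y≉0 ω≉0 γ≉0 , ¬sq ∘ IsSquare-resp (expr-ω* _))
      (ω*-moves ∘ proj₁) (λ {γ} _ → ω*³≈id γ))

  cube-root-of-4ρinv : ∀ {ρ} → ρ * ρinv ≈ 1# → 2 · 1# ≉ 0# → IsCube F (- ((1# + 1#) * ρ)) →
                       ∃ λ κ → κ ≉ 0# × κ * κ * κ ≈ four F * ρinv
  cube-root-of-4ρinv {ρ} ρ*ρinv≈1 2≉0 (c , c³≈-2ρ) = c * c * ρinv , x*y≉0 (x*y≉0 c≉0 c≉0) ρinv≉0 , (begin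
    (c * c * ρinv) * (c * c * ρinv) * (c * c * ρinv)
      ≈⟨ solve 2 (λ c r → (c :* c :* r) :* (c :* c :* r) :* (c :* c :* r)
                         := (c :* c :* c) :* (c :* c :* c) :* (r :* r :* r)) refl c ρinv ⟩
    (c * c * c) * (c * c * c) * (ρinv * ρinv * ρinv)
      ≈⟨ *-congʳ (*-cong c³≈-2ρ c³≈-2ρ) ⟩
    - (2 · 1# * ρ) * - (2 · 1# * ρ) * (ρinv * ρinv * ρinv)
      ≈⟨ solve 2 (λ p r → :- (con (+ 2) :* p) :* :- (con (+ 2) :* p) :* (r :* r :* r)
                         := con (+ 4) :* r :* ((p :* r) :* (p :* r))) refl ρ ρinv ⟩
    four F * ρinv * ((ρ * ρinv) * (ρ * ρinv))
      ≈⟨ *-congˡ (*-cong ρ*ρinv≈1 ρ*ρinv≈1) ⟩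
    four F * ρinv * (1# * 1#)
      ≈⟨ solve 1 (λ x → x :* (con (+ 1) :* con (+ 1)) := x) refl (four F * ρinv) ⟩
    four F * ρinv ∎)
    where
    ρ≉0 : ρ ≉ 0#
    ρ≉0 = x*y≈1⇒x≉0 ρ*ρinv≈1
    ρinv≉0 : ρinv ≉ 0#
    ρinv≉0 = x*y≈1⇒x≉0 (trans (*-comm ρinv ρ) ρ*ρinv≈1)
    c≉0 : c ≉ 0#
    c≉0 c≈0 = x*y≉0 2≉0 ρ≉0 (begin
      2 · 1# * ρ           ≈⟨ -‿involutive _ ⟨
      - (- (2 · 1# * ρ))   ≈⟨ -‿cong c³≈-2ρ ⟨
      - (c * c * c)        ≈⟨ -‿cong (*-cong (*-cong c≈0 c≈0) c≈0) ⟩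
      - (0# * 0# * 0#)     ≈⟨ solve 0 (:- (con (+ 0) :* con (+ 0) :* con (+ 0)) := con (+ 0)) refl ⟩
      0#                   ∎)

  module _ (2≉0 : 2 · 1# ≉ 0#) (3≉0 : 3 · 1# ≉ 0#) {ω : Carrier} (root : Root ω)
           {κ : Carrier} (κ≉0 : κ ≉ 0#) (κ³≈4ρinv : κ * κ * κ ≈ four F * ρinv) where

    open Cubic F
    open Inversion 3≉0
    open Negation 2≉0 3≉0 root

    A : Carrier → Carrier
    A γ = 1# + κ * γ

    B : Carrier → Carrier
    B u = (u - 1#) * κ ⁻¹

    B∘A≈id : ∀ γ → B (A γ) ≈ γ
    B∘A≈id γ = begin
      (1# + κ * γ - 1#) * κ ⁻¹
        ≈⟨ solve 3 (λ κ γ κ′ → (con (+ 1) :+ κ :* γ :- con (+ 1)) :* κ′ := γ :* (κ :* κ′)) refl κ γ (κ ⁻¹) ⟩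
      γ * (κ * κ ⁻¹)
        ≈⟨ *-congˡ (x*x⁻¹≈1 κ≉0) ⟩
      γ * 1#
        ≈⟨ *-identityʳ γ ⟩
      γ ∎

    A∘B≈id : ∀ u → A (B u) ≈ u
    A∘B≈id u = begin
      1# + κ * ((u - 1#) * κ ⁻¹)
        ≈⟨ solve 3 (λ κ u κ′ → con (+ 1) :+ κ :* ((u :- con (+ 1)) :* κ′) := con (+ 1) :+ (u :- con (+ 1)) :* (κ :* κ′))
                   refl κ u (κ ⁻¹) ⟩
      1# + (u - 1#) * (κ * κ ⁻¹)
        ≈⟨ +-congˡ (*-congˡ (x*x⁻¹≈1 κ≉0)) ⟩
      1# + (u - 1#) * 1#
        ≈⟨ solve 1 (λ u → con (+ 1) :+ (u :- con (+ 1)) :* con (+ 1) := u) refl u ⟩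
      u ∎

    expr≈cubic∘A : ∀ γ → expr F ρinv γ ≈ cubic (A γ)
    expr≈cubic∘A γ = begin
      1# + four F * ρinv * (γ * γ * γ)
        ≈⟨ +-congˡ (*-congʳ κ³≈4ρinv) ⟨
      1# + κ * κ * κ * (γ * γ * γ)
        ≈⟨ solve 2 (λ κ γ → con (+ 1) :+ κ :* κ :* κ :* (γ :* γ :* γ) := :cubic (con (+ 1) :+ κ :* γ)) refl κ γ ⟩
      cubic (A γ) ∎

    A≈1⇒≈0 : ∀ {γ} → A γ ≈ 1# → γ ≈ 0#
    A≈1⇒≈0 {γ} Aγ≈1 = *-cancelˡ κ≉0 (begin
      κ * γ      ≈⟨ solve 2 (λ κ γ → κ :* γ := con (+ 1) :+ κ :* γ :- con (+ 1)) refl κ γ ⟩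
      A γ - 1#   ≈⟨ +-congʳ Aγ≈1 ⟩
      1# - 1#    ≈⟨ solve 1 (λ κ → con (+ 1) :- con (+ 1) := κ :* con (+ 0)) refl κ ⟩
      κ * 0#     ∎)

    ≈0⇒A≈1 : ∀ {γ} → γ ≈ 0# → A γ ≈ 1#
    ≈0⇒A≈1 {γ} γ≈0 = trans (+-congˡ (trans (*-congˡ γ≈0) (zeroʳ κ))) (+-identityʳ 1#)

    Counted≐NonSq∘A : Counted ≐ (NonSq ∘ A)
    Counted≐NonSq∘A = (λ {γ} (γ≉0 , ¬sq) → γ≉0 ∘ A≈1⇒≈0 , ¬sq ∘ IsSquare-resp (sym (expr≈cubic∘A γ)))
                    , (λ {γ} (Aγ≉1 , ¬sq) → Aγ≉1 ∘ ≈0⇒A≈1 , ¬sq ∘ IsSquare-resp (expr≈cubic∘A γ))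

    2∣#fixed : 2 ∣ # ((NonSq? ∩? Sqrt3?) ∘ A)
    2∣#fixed = involution⇒2∣#∘ (+-congˡ ∘ *-congˡ) (*-congʳ ∘ +-congʳ) B∘A≈id A∘B≈id
      (λ u≈v (nsq , u²≈3) → NonSq-resp u≈v nsq , Sqrt3-resp u≈v u²≈3) (NonSq? ∩? Sqrt3?) -‿cong
      (λ (nsq , u²≈3) → NonSq-neg nsq u²≈3 , Sqrt3-neg u²≈3) (neg-moves ∘ proj₁)
      (λ _ → -‿involutive _)

    2∣#moved : 2 ∣ # ((NonSq? ∩? ∁? Sqrt3?) ∘ A)
    2∣#moved = involution⇒2∣#∘ (+-congˡ ∘ *-congˡ) (*-congʳ ∘ +-congʳ) B∘A≈id A∘B≈id
      (λ u≈v (nsq , ¬u²≈3) → NonSq-resp u≈v nsq , ¬u²≈3 ∘ Sqrt3-resp (sym u≈v)) (NonSq? ∩? ∁? Sqrt3?) ι-cong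
      (λ (nsq , ¬u²≈3) → NonSq-ι nsq , ¬Sqrt3-ι nsq ¬u²≈3) (λ (nsq , ¬u²≈3) → ι-moves nsq ¬u²≈3)
      (λ (nsq , _) → ι-involutive (NonSq⇒≉0 nsq))

    2∣N : 2 ∣ N F ρinv
    2∣N = ≡.subst (2 ∣_) (≡.sym N≡fixed+moved) (∣m∣n⇒∣m+n 2∣#fixed 2∣#moved)
      where
      N≡fixed+moved : N F ρinv ≡ # ((NonSq? ∩? Sqrt3?) ∘ A) ℕ.+ # ((NonSq? ∩? ∁? Sqrt3?) ∘ A)
      N≡fixed+moved = ≡.trans N≡#Counted (≡.trans (#-≐ Counted? (NonSq? ∘ A) Counted≐NonSq∘A)
                                                  (count-partition (NonSq? ∘ A ∘ enum) (Sqrt3? ∘ A ∘ enum)))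

corollary9p6 : ∀ {c ℓ : Level} (F : FiniteField c ℓ) →
    let open FiniteField F in
    FiniteField.size F % 2 ≡ 1 → FiniteField.size F % 3 ≡ 1 →
    ∀ (ρ ρinv : Carrier) → ρ * ρinv ≈ 1# →
    (3 ∣ N F ρinv) × (IsCube F (- ((1# + 1#) * ρ)) → 6 ∣ N F ρinv)
corollary9p6 F size≡1[2] size≡1[3] ρ ρinv ρ*ρinv≈1 = 3∣N root 3≉0′ , λ cube →
  let κ , κ≉0 , κ³≈4ρinv = cube-root-of-4ρinv ρ*ρinv≈1 2≉0′ cube
  in  2∧3∣⇒6∣ (2∣N 2≉0′ 3≉0′ root κ≉0 κ³≈4ρinv) (3∣N root 3≉0′)
  where
  open FieldTheory F
  open Count F ρinv
  2≉0′ = 2≉0 size≡1[2]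
  3≉0′ = 3≉0 size≡1[3]
  root = proj₂ (∃-root-of-unity size≡1[3])
  2∧3∣⇒6∣ : ∀ {n} → 2 ∣ n → 3 ∣ n → 6 ∣ n
  2∧3∣⇒6∣ = lcm-least
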